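{- Let $N$ be an even integer. Then (1) if $N\geq 6$, $f\!\left(N,\frac N2\right)=\frac{N^2}{4}+3$; (2) if $N\geq 10$, $f\!\left(N,\frac N2+1\right)>f\!\left(N,\frac N2\right)$.
   Context: All graphs are finite and simple; $L(G)$ is the line graph, so $e(L(G))=\sum_v\binom{\deg(v)}{2}$. For integers $N\ge\Delta\ge1$, $f(N,\Delta)=\max\{e(L(G)) : e(G)=N,\ \Delta(G)=\Delta,\ \delta(G)\geq1\}$. -}

module Defs where

open import Data.Nat using (ℕ; _+_; _*_; _⊔_; _≤_; _<ᵇ_)
open import Data.Nat.Combinatorics using (_C_)
open import Data.Bool using (Bool; true; false; if_then_else_; _∧_)
open import Data.Fin using (Fin; toℕ)
open import Data.List using (List; map; foldr; allFin)
open import Data.Nat.ListAction using (sum)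
open import Data.Product using (Σ; _×_; ∃-syntax)
open import Relation.Binary.PropositionalEquality using (_≡_)

record Graph (n : ℕ) : Set where
  field
    adj    : Fin n → Fin n → Bool
    sym    : ∀ i j → adj i j ≡ adj j i
    irrefl : ∀ i → adj i i ≡ false
open Graph public

ind : Bool → ℕ
ind true  = 1
ind false = 0

deg : ∀ {n} → Graph n → Fin n → ℕ
deg {n} G v = sum (map (λ w → ind (adj G v w)) (allFin n))

edges : ∀ {n} → Graph n → ℕ
edges {n} G =
  sum (map (λ i → sum (map (λ j → ind ((toℕ i <ᵇ toℕ j) ∧ adj G i j))
                           (allFin n)))
           (allFin n))

-- maximum degree Δ(G) (0 for the empty vertex set)
maxDeg : ∀ {n} → Graph n → ℕ
maxDeg {n} G = foldr _⊔_ 0 (map (deg G) (allFin n))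

MinDegPos : ∀ {n} → Graph n → Set
MinDegPos {n} G = ∀ v → 1 ≤ deg G v

-- e(L(G)) = Σ_v C(deg v, 2)
lineEdges : ∀ {n} → Graph n → ℕ
lineEdges {n} G = sum (map (λ v → deg G v C 2) (allFin n))

Attained : ℕ → ℕ → ℕ → Set
Attained N Δ m = ∃[ n ] Σ (Graph n) λ G →
  (edges G ≡ N) × (maxDeg G ≡ Δ) × MinDegPos G × (lineEdges G ≡ m)

-- f(N,Δ) = m : m is attained and is the maximum of all attained values
IsF : ℕ → ℕ → ℕ → Set
IsF N Δ m = Attained N Δ m × (∀ m′ → Attained N Δ m′ → m′ ≤ m)

{-# OPTIONS --safe #-}
module Submission where

{-
Deleting the edges at a vertex u splits the pairs of adjacent edges into the C(d(u), 2) pairs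
at u and the rest, which number e(L(G - u)) + Σ_{v ∼ u} d_{G - u}(v).  Since e(L(H)) ≤ C(e(H), 2)
and the neighbour sum is at most 2 e(G - u), a vertex of maximum degree Δ gives
f(N, Δ) ≤ C(Δ, 2) + C(N - Δ, 2) + 2 (N - Δ), which a hub with a pendant attains for Δ = N/2 + 1.
For Δ = k = N/2 the k edges of G - u are examined through a second vertex w: if all degrees in
G - u are at most 2, the rest is at most 3k; if d_{G - u}(w) = D ≥ 3 and G - u - w keeps an edge,
the bound above applied at w leaves slack (D - 3)(e(G - u - w) - 1); and if G - u is a star at w,
then w is not adjacent to u, so the neighbour sum is at most k.  Two joined hubs plus one extra
edge attain k² + 3, and C(k + 1, 2) + C(k - 1, 2) + 2(k - 1) exceeds it once k ≥ 5.
-}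

open import Defs hiding (sym)
open import Data.Nat using (ℕ; zero; suc; _+_; _*_; _⊔_; _≤_; _<_; _<ᵇ_; _≡ᵇ_; z≤n; s≤s; z<s; _≤?_)
open import Data.Nat.Properties hiding (_≟_)
open import Data.Nat.Combinatorics using (_C_; nCk+nC[k+1]≡[n+1]C[k+1]; nC1≡n)
open import Data.Nat.Induction using (<-rec)
open import Data.Nat.ListAction using (sum)
open import Data.Nat.Tactic.RingSolver using (solve-∀)
open import Algebra.Properties.Semiring.Sum +-*-semiring
  using (sum-syntax; sum-cong-≗; ∑-distrib-+; ∑-comm; *-distribʳ-sum)
open import Data.Bool using (Bool; true; false; _∧_; _∨_; not)
open import Data.Bool.Properties using (∧-comm; ∧-zeroʳ; ∨-comm)
open import Data.Fin using (Fin; toℕ) renaming (zero to fzero; suc to fsuc)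
open import Data.Fin.Properties using (_≟_; toℕ-injective; any?)
open import Data.List using ([]; _∷_; map; foldr; allFin; tabulate)
open import Data.List.Properties using (foldr-preservesᵇ)
open import Data.List.Relation.Unary.All.Properties as All using (tabulate⁺)
open import Data.List.Relation.Unary.Any using (here; there)
open import Data.List.Membership.Propositional using (_∈_)
open import Data.List.Membership.Propositional.Properties using (∈-allFin; ∈-map⁺; ∈-map⁻)
open import Data.Product using (_×_; _,_; ∃-syntax; proj₁; proj₂)
open import Data.Sum using (_⊎_; inj₁; inj₂)
open import Relation.Nullary using (Dec; yes; no; does; contradiction)
open import Relation.Nullary.Decidable using (dec-true; dec-false)
open import Relation.Binary.PropositionalEquality

∑-mono-≤ : ∀ n {f g : Fin n → ℕ} → (∀ i → f i ≤ g i) → ∑[ i < n ] f i ≤ ∑[ i < n ] g i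
∑-mono-≤ zero    f≤g = z≤n
∑-mono-≤ (suc n) f≤g = +-mono-≤ (f≤g fzero) (∑-mono-≤ n (λ i → f≤g (fsuc i)))

∑-const : ∀ n c → ∑[ i < n ] c ≡ n * c
∑-const zero    c = refl
∑-const (suc n) c = cong (c +_) (∑-const n c)

∑-zero : ∀ n → ∑[ i < n ] 0 ≡ 0
∑-zero zero    = refl
∑-zero (suc n) = ∑-zero n

∑-ones : ∀ n → ∑[ i < n ] 1 ≡ n
∑-ones n = trans (∑-const n 1) (*-identityʳ n)

∑-select : ∀ n (u : Fin n) (g : Fin n → ℕ) → ∑[ i < n ] (ind (does (i ≟ u)) * g i) ≡ g u
∑-select (suc n) fzero    g = trans (cong (g fzero + 0 +_) (∑-zero n)) (trans (+-identityʳ _) (+-identityʳ _))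
∑-select (suc n) (fsuc u) g = ∑-select n u (λ i → g (fsuc i))

ind-*-≤ : ∀ b x → ind b * x ≤ x
ind-*-≤ true  x = ≤-reflexive (+-identityʳ x)
ind-*-≤ false x = z≤n

∑-ind-*-+-≤ : ∀ n (b : Fin n → Bool) (f : Fin n → ℕ) w → b w ≡ false →
              ∑[ i < n ] (ind (b i) * f i) + f w ≤ ∑[ i < n ] f i
∑-ind-*-+-≤ n b f w bw≡false = begin
  ∑[ i < n ] (ind (b i) * f i) + f w
    ≡⟨ cong (∑[ i < n ] (ind (b i) * f i) +_) (∑-select n w f) ⟨
  ∑[ i < n ] (ind (b i) * f i) + ∑[ i < n ] (ind (does (i ≟ w)) * f i)
    ≡⟨ ∑-distrib-+ (λ i → ind (b i) * f i) (λ i → ind (does (i ≟ w)) * f i) ⟨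
  ∑[ i < n ] (ind (b i) * f i + ind (does (i ≟ w)) * f i)
    ≤⟨ ∑-mono-≤ n pointwise ⟩
  ∑[ i < n ] f i
    ∎
  where
  open ≤-Reasoning
  pointwise : ∀ i → ind (b i) * f i + ind (does (i ≟ w)) * f i ≤ f i
  pointwise i with i ≟ w
  ... | yes refl rewrite bw≡false = ≤-reflexive (+-identityʳ (f i))
  ... | no _     = ≤-trans (≤-reflexive (+-identityʳ _)) (ind-*-≤ (b i) (f i))

sum-map-tabulate : ∀ {A : Set} n (f : A → ℕ) (g : Fin n → A) → sum (map f (tabulate g)) ≡ ∑[ i < n ] f (g i)
sum-map-tabulate zero    f g = refl
sum-map-tabulate (suc n) f g = cong (f (g fzero) +_) (sum-map-tabulate n f (λ i → g (fsuc i)))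

sum-map-allFin : ∀ n (f : Fin n → ℕ) → sum (map f (allFin n)) ≡ ∑[ i < n ] f i
sum-map-allFin n f = sum-map-tabulate n f (λ i → i)

C2-suc : ∀ n → suc n C 2 ≡ n C 2 + n
C2-suc n = begin
  suc n C 2          ≡⟨ nCk+nC[k+1]≡[n+1]C[k+1] n 1 ⟨
  n C 1 + n C 2      ≡⟨ cong (_+ n C 2) (nC1≡n n) ⟩
  n + n C 2          ≡⟨ +-comm n (n C 2) ⟩
  n C 2 + n          ∎
  where open ≡-Reasoning

C2-+ : ∀ a b → (a + b) C 2 ≡ a C 2 + b C 2 + a * b
C2-+ zero    b = sym (+-identityʳ (b C 2))
C2-+ (suc a) b = begin
  suc (a + b) C 2                          ≡⟨ C2-suc (a + b) ⟩
  (a + b) C 2 + (a + b)                    ≡⟨ cong (_+ (a + b)) (C2-+ a b) ⟩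
  a C 2 + b C 2 + a * b + (a + b)          ≡⟨ shuffle (a C 2) (b C 2) a b ⟩
  (a C 2 + a) + b C 2 + (b + a * b)        ≡⟨ cong (λ x → x + b C 2 + (b + a * b)) (C2-suc a) ⟨
  suc a C 2 + b C 2 + suc a * b            ∎
  where
  open ≡-Reasoning
  shuffle : ∀ x y a b → x + y + a * b + (a + b) ≡ (x + a) + y + (b + a * b)
  shuffle = solve-∀

C2-+ind : ∀ x b → (x + ind b) C 2 ≡ x C 2 + ind b * x
C2-+ind x true  = trans (C2-+ x 1) (cong₂ _+_ (+-identityʳ (x C 2)) (*-comm x 1))
C2-+ind x false = trans (cong (_C 2) (+-identityʳ x)) (sym (+-identityʳ (x C 2)))

C2-+ind-≤ : ∀ x b → x ≤ 2 → x C 2 + ind b * x ≤ x + ind b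
C2-+ind-≤ 0 true  _ = z≤n
C2-+ind-≤ 0 false _ = z≤n
C2-+ind-≤ 1 true  _ = s≤s z≤n
C2-+ind-≤ 1 false _ = z≤n
C2-+ind-≤ 2 true  _ = ≤-refl
C2-+ind-≤ 2 false _ = s≤s z≤n
C2-+ind-≤ (suc (suc (suc _))) _ (s≤s (s≤s ()))

C2-double : ∀ n → n C 2 + n C 2 + n ≡ n * n
C2-double zero    = refl
C2-double (suc n) = begin
  suc n C 2 + suc n C 2 + suc n              ≡⟨ cong (λ c → c + c + suc n) (C2-suc n) ⟩
  n C 2 + n + (n C 2 + n) + suc n            ≡⟨ shuffle (n C 2) n ⟩
  (n C 2 + n C 2 + n) + (n + suc n)          ≡⟨ cong (_+ (n + suc n)) (C2-double n) ⟩
  n * n + (n + suc n)                        ≡⟨ square-suc n ⟩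
  suc n * suc n                              ∎
  where
  open ≡-Reasoning
  shuffle : ∀ c n → c + n + (c + n) + suc n ≡ (c + c + n) + (n + suc n)
  shuffle = solve-∀
  square-suc : ∀ n → n * n + (n + suc n) ≡ suc n * suc n
  square-suc = solve-∀

C2-pair : ∀ k → k C 2 + suc k C 2 ≡ k * k
C2-pair k = trans (cong (k C 2 +_) (C2-suc k)) (trans (sym (+-assoc (k C 2) (k C 2) k)) (C2-double k))

-- Degrees, edges and the handshake lemma

deg-∑ : ∀ {n} (G : Graph n) v → deg G v ≡ ∑[ w < n ] ind (adj G v w)
deg-∑ {n} G v = sum-map-allFin n _

edges-∑ : ∀ {n} (G : Graph n) → edges G ≡ ∑[ i < n ] ∑[ j < n ] ind ((toℕ i <ᵇ toℕ j) ∧ adj G i j)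
edges-∑ {n} G =
  trans (sum-map-allFin n _) (sum-cong-≗ (λ i → sum-map-allFin n (λ j → ind ((toℕ i <ᵇ toℕ j) ∧ adj G i j))))

lineEdges-∑ : ∀ {n} (G : Graph n) → lineEdges G ≡ ∑[ v < n ] (deg G v C 2)
lineEdges-∑ {n} G = sum-map-allFin n _

ind-split-<ᵇ : ∀ a b c → (a ≡ b → c ≡ false) → ind c ≡ ind ((a <ᵇ b) ∧ c) + ind ((b <ᵇ a) ∧ c)
ind-split-<ᵇ zero    zero    c a≡b⇒¬c rewrite a≡b⇒¬c refl = refl
ind-split-<ᵇ zero    (suc b) c _      = sym (+-identityʳ _)
ind-split-<ᵇ (suc a) zero    c _      = refl
ind-split-<ᵇ (suc a) (suc b) c a≡b⇒¬c = ind-split-<ᵇ a b c (λ a≡b → a≡b⇒¬c (cong suc a≡b))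

handshake : ∀ {n} (G : Graph n) → ∑[ v < n ] deg G v ≡ 2 * edges G
handshake {n} G = begin
  ∑[ i < n ] deg G i
    ≡⟨ sum-cong-≗ (deg-∑ G) ⟩
  ∑[ i < n ] ∑[ j < n ] ind (adj G i j)
    ≡⟨ sum-cong-≗ (λ i → sum-cong-≗ (adj-split i)) ⟩
  ∑[ i < n ] ∑[ j < n ] (A i j + A j i)
    ≡⟨ sum-cong-≗ (λ i → ∑-distrib-+ (A i) (λ j → A j i)) ⟩
  ∑[ i < n ] (∑[ j < n ] A i j + ∑[ j < n ] A j i)
    ≡⟨ ∑-distrib-+ (λ i → ∑[ j < n ] A i j) (λ i → ∑[ j < n ] A j i) ⟩
  E + ∑[ i < n ] ∑[ j < n ] A j i
    ≡⟨ cong (E +_) (∑-comm (λ i j → A j i)) ⟩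
  E + E
    ≡⟨ cong (E +_) (+-identityʳ E) ⟨
  2 * E
    ≡⟨ cong (2 *_) (edges-∑ G) ⟨
  2 * edges G
    ∎
  where
  open ≡-Reasoning
  A : Fin n → Fin n → ℕ
  A i j = ind ((toℕ i <ᵇ toℕ j) ∧ adj G i j)
  E : ℕ
  E = ∑[ i < n ] ∑[ j < n ] A i j
  adj-split : ∀ i j → ind (adj G i j) ≡ A i j + A j i
  adj-split i j = trans
    (ind-split-<ᵇ (toℕ i) (toℕ j) (adj G i j)
                  (λ i≡j → subst (λ x → adj G i x ≡ false) (toℕ-injective i≡j) (irrefl G i)))
    (cong (λ b → A i j + ind ((toℕ j <ᵇ toℕ i) ∧ b)) (Graph.sym G i j))

lineEdges≡0 : ∀ {n} (G : Graph n) → (∀ v → deg G v ≡ 0) → lineEdges G ≡ 0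
lineEdges≡0 {n} G deg≡0 =
  trans (lineEdges-∑ G) (trans (sum-cong-≗ (λ v → cong (_C 2) (deg≡0 v))) (∑-zero n))

foldr-⊔-upper : ∀ {x} xs → x ∈ xs → x ≤ foldr _⊔_ 0 xs
foldr-⊔-upper (y ∷ xs) (here refl)  = m≤m⊔n y _
foldr-⊔-upper (y ∷ xs) (there x∈xs) = ≤-trans (foldr-⊔-upper xs x∈xs) (m≤n⊔m y _)

foldr-⊔-attained : ∀ xs → foldr _⊔_ 0 xs ≡ 0 ⊎ foldr _⊔_ 0 xs ∈ xs
foldr-⊔-attained []       = inj₁ refl
foldr-⊔-attained (y ∷ xs) with ⊔-sel y (foldr _⊔_ 0 xs)
... | inj₁ max≡y = inj₂ (here max≡y)
... | inj₂ max≡rest with foldr-⊔-attained xs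
...   | inj₁ rest≡0   = inj₁ (trans max≡rest rest≡0)
...   | inj₂ rest∈xs  = inj₂ (there (subst (_∈ xs) (sym max≡rest) rest∈xs))

deg≤maxDeg : ∀ {n} (G : Graph n) v → deg G v ≤ maxDeg G
deg≤maxDeg G v = foldr-⊔-upper _ (∈-map⁺ (deg G) (∈-allFin v))

maxDeg≤ : ∀ {n} (G : Graph n) {M} → (∀ v → deg G v ≤ M) → maxDeg G ≤ M
maxDeg≤ G {M} deg≤M = foldr-preservesᵇ {P = _≤ M} ⊔-lub z≤n (All.map⁺ (tabulate⁺ deg≤M))

maxDeg-attained : ∀ {n} (G : Graph n) → 0 < maxDeg G → ∃[ v ] deg G v ≡ maxDeg G
maxDeg-attained {n} G 0<max with foldr-⊔-attained (map (deg G) (allFin n))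
... | inj₁ max≡0  = contradiction (subst (0 <_) max≡0 0<max) (<-irrefl refl)
... | inj₂ max∈   with ∈-map⁻ (deg G) max∈
...   | v , _ , max≡deg = v , sym max≡deg

deg≤Δ : ∀ {n} (G : Graph n) {Δ} → maxDeg G ≡ Δ → ∀ v → deg G v ≤ Δ
deg≤Δ G maxDeg≡Δ v = subst (deg G v ≤_) maxDeg≡Δ (deg≤maxDeg G v)

maxDeg-vertex : ∀ {n} (G : Graph n) {Δ} → 0 < Δ → maxDeg G ≡ Δ → ∃[ u ] deg G u ≡ Δ
maxDeg-vertex G 0<Δ maxDeg≡Δ with maxDeg-attained G (subst (0 <_) (sym maxDeg≡Δ) 0<Δ)
... | u , du≡max = u , trans du≡max maxDeg≡Δ

-- Deleting the edges at a vertex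

isolate : ∀ {n} → Graph n → Fin n → Graph n
isolate G u = record
  { adj    = λ i j → adj G i j ∧ not (does (i ≟ u)) ∧ not (does (j ≟ u))
  ; sym    = λ i j → cong₂ _∧_ (Graph.sym G i j) (∧-comm (not (does (i ≟ u))) (not (does (j ≟ u))))
  ; irrefl = λ i → cong (_∧ _) (irrefl G i)
  }

ind-split : ∀ a b → ind a ≡ ind (a ∧ not b) + ind b * ind a
ind-split true  true  = refl
ind-split true  false = refl
ind-split false true  = refl
ind-split false false = refl

deg-isolate-self : ∀ {n} (G : Graph n) u → deg (isolate G u) u ≡ 0
deg-isolate-self {n} G u = begin
  deg (isolate G u) u                         ≡⟨ deg-∑ (isolate G u) u ⟩
  ∑[ w < n ] ind (adj (isolate G u) u w)      ≡⟨ sum-cong-≗ (λ w → cong ind (no-edge w)) ⟩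
  ∑[ w < n ] 0                                ≡⟨ ∑-zero n ⟩
  0                                           ∎
  where
  open ≡-Reasoning
  no-edge : ∀ w → adj (isolate G u) u w ≡ false
  no-edge w rewrite dec-true (u ≟ u) refl = ∧-zeroʳ (adj G u w)

deg-isolate : ∀ {n} (G : Graph n) u v → v ≢ u → deg G v ≡ deg (isolate G u) v + ind (adj G u v)
deg-isolate {n} G u v v≢u = begin
  deg G v
    ≡⟨ deg-∑ G v ⟩
  ∑[ w < n ] ind (adj G v w)
    ≡⟨ sum-cong-≗ (λ w → ind-split (adj G v w) (does (w ≟ u))) ⟩
  ∑[ w < n ] (ind (adj G v w ∧ not (does (w ≟ u))) + ind (does (w ≟ u)) * ind (adj G v w))
    ≡⟨ ∑-distrib-+ (λ w → ind (adj G v w ∧ not (does (w ≟ u)))) (λ w → ind (does (w ≟ u)) * ind (adj G v w)) ⟩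
  ∑[ w < n ] ind (adj G v w ∧ not (does (w ≟ u))) + ∑[ w < n ] (ind (does (w ≟ u)) * ind (adj G v w))
    ≡⟨ cong₂ _+_ (sym deg-H) (∑-select n u (λ w → ind (adj G v w))) ⟩
  deg (isolate G u) v + ind (adj G v u)
    ≡⟨ cong (λ b → deg (isolate G u) v + ind b) (Graph.sym G v u) ⟩
  deg (isolate G u) v + ind (adj G u v)
    ∎
  where
  open ≡-Reasoning
  deg-H : deg (isolate G u) v ≡ ∑[ w < n ] ind (adj G v w ∧ not (does (w ≟ u)))
  deg-H = trans (deg-∑ (isolate G u) v)
    (sum-cong-≗ (λ w → cong (λ b → ind (adj G v w ∧ not b ∧ not (does (w ≟ u)))) (dec-false (v ≟ u) v≢u)))

deg-isolate-split : ∀ {n} (G : Graph n) u v →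
                    deg G v ≡ deg (isolate G u) v + ind (adj G u v) + ind (does (v ≟ u)) * deg G u
deg-isolate-split G u v = split (v ≟ u)
  where
  split : (v≟u : Dec (v ≡ u)) → deg G v ≡ deg (isolate G u) v + ind (adj G u v) + ind (does v≟u) * deg G u
  split (yes v≡u) = subst (λ x → deg G x ≡ deg (isolate G u) x + ind (adj G u x) + (deg G u + 0)) (sym v≡u)
    (sym (trans (cong₂ (λ d b → d + ind b + (deg G u + 0)) (deg-isolate-self G u) (irrefl G u)) (+-identityʳ (deg G u))))
  split (no v≢u)  = trans (deg-isolate G u v v≢u) (sym (+-identityʳ _))

edges-isolate : ∀ {n} (G : Graph n) u → edges G ≡ edges (isolate G u) + deg G u
edges-isolate {n} G u = *-cancelˡ-≡ _ _ 2 (begin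
  2 * edges G
    ≡⟨ handshake G ⟨
  ∑[ v < n ] deg G v
    ≡⟨ sum-cong-≗ (deg-isolate-split G u) ⟩
  ∑[ v < n ] (deg H v + ind (adj G u v) + ind (does (v ≟ u)) * deg G u)
    ≡⟨ ∑-distrib-+ (λ v → deg H v + ind (adj G u v)) (λ v → ind (does (v ≟ u)) * deg G u) ⟩
  ∑[ v < n ] (deg H v + ind (adj G u v)) + ∑[ v < n ] (ind (does (v ≟ u)) * deg G u)
    ≡⟨ cong₂ _+_ (∑-distrib-+ (deg H) (λ v → ind (adj G u v))) (∑-select n u (λ _ → deg G u)) ⟩
  ∑[ v < n ] deg H v + ∑[ v < n ] ind (adj G u v) + deg G u
    ≡⟨ cong₂ (λ x y → x + y + deg G u) (handshake H) (sym (deg-∑ G u)) ⟩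
  2 * edges H + deg G u + deg G u
    ≡⟨ regroup (edges H) (deg G u) ⟩
  2 * (edges H + deg G u)
    ∎)
  where
  open ≡-Reasoning
  H : Graph n
  H = isolate G u
  regroup : ∀ e d → 2 * e + d + d ≡ 2 * (e + d)
  regroup = solve-∀

edges-isolate-≡ : ∀ {n} (G : Graph n) u {d e} → deg G u ≡ d → edges G ≡ d + e → edges (isolate G u) ≡ e
edges-isolate-≡ G u {d} {e} du≡d eG≡d+e = +-cancelʳ-≡ d _ _ (begin
  edges (isolate G u) + d          ≡⟨ cong (edges (isolate G u) +_) du≡d ⟨
  edges (isolate G u) + deg G u    ≡⟨ edges-isolate G u ⟨
  edges G                          ≡⟨ eG≡d+e ⟩
  d + e                            ≡⟨ +-comm d e ⟩
  e + d                            ∎)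
  where open ≡-Reasoning

deg≤edges : ∀ {n} (G : Graph n) u → deg G u ≤ edges G
deg≤edges G u = subst (deg G u ≤_) (sym (edges-isolate G u)) (m≤n+m (deg G u) _)

neighbourDegreeSum : ∀ {n} → Graph n → Fin n → ℕ
neighbourDegreeSum {n} G u = ∑[ v < n ] (ind (adj G u v) * deg (isolate G u) v)

-- The pairs of adjacent edges of G that do not both contain u.
lineEdgesOff : ∀ {n} → Graph n → Fin n → ℕ
lineEdgesOff G u = lineEdges (isolate G u) + neighbourDegreeSum G u

C2-deg-isolate-split : ∀ {n} (G : Graph n) u v →
  deg G v C 2 ≡ ind (does (v ≟ u)) * (deg G u C 2) + (deg (isolate G u) v C 2 + ind (adj G u v) * deg (isolate G u) v)
C2-deg-isolate-split {n} G u v = split (v ≟ u)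
  where
  H : Graph n
  H = isolate G u
  split : (v≟u : Dec (v ≡ u)) →
          deg G v C 2 ≡ ind (does v≟u) * (deg G u C 2) + (deg H v C 2 + ind (adj G u v) * deg H v)
  split (yes v≡u) = subst (λ x → deg G x C 2 ≡ (deg G u C 2 + 0) + (deg H x C 2 + ind (adj G u x) * deg H x)) (sym v≡u)
    (sym (trans (cong₂ (λ d b → (deg G u C 2 + 0) + (d C 2 + ind b * d)) (deg-isolate-self G u) (irrefl G u))
                (trans (+-identityʳ _) (+-identityʳ _))))
  split (no v≢u)  = trans (cong (_C 2) (deg-isolate G u v v≢u)) (C2-+ind (deg H v) (adj G u v))

lineEdges-isolate : ∀ {n} (G : Graph n) u → lineEdges G ≡ deg G u C 2 + lineEdgesOff G u
lineEdges-isolate {n} G u = begin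
  lineEdges G
    ≡⟨ lineEdges-∑ G ⟩
  ∑[ v < n ] (deg G v C 2)
    ≡⟨ sum-cong-≗ (C2-deg-isolate-split G u) ⟩
  ∑[ v < n ] (ind (does (v ≟ u)) * (deg G u C 2) + (deg H v C 2 + ind (adj G u v) * deg H v))
    ≡⟨ ∑-distrib-+ (λ v → ind (does (v ≟ u)) * (deg G u C 2)) (λ v → deg H v C 2 + ind (adj G u v) * deg H v) ⟩
  ∑[ v < n ] (ind (does (v ≟ u)) * (deg G u C 2)) + ∑[ v < n ] (deg H v C 2 + ind (adj G u v) * deg H v)
    ≡⟨ cong₂ _+_ (∑-select n u (λ _ → deg G u C 2))
                 (∑-distrib-+ (λ v → deg H v C 2) (λ v → ind (adj G u v) * deg H v)) ⟩
  deg G u C 2 + (∑[ v < n ] (deg H v C 2) + neighbourDegreeSum G u)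
    ≡⟨ cong (λ x → deg G u C 2 + (x + neighbourDegreeSum G u)) (lineEdges-∑ H) ⟨
  deg G u C 2 + lineEdgesOff G u
    ∎
  where
  open ≡-Reasoning
  H : Graph n
  H = isolate G u

neighbourDegreeSum≤2*edges : ∀ {n} (G : Graph n) u → neighbourDegreeSum G u ≤ 2 * edges (isolate G u)
neighbourDegreeSum≤2*edges {n} G u = begin
  neighbourDegreeSum G u               ≤⟨ ∑-mono-≤ n (λ v → ind-*-≤ (adj G u v) (deg (isolate G u) v)) ⟩
  ∑[ v < n ] deg (isolate G u) v       ≡⟨ handshake (isolate G u) ⟩
  2 * edges (isolate G u)              ∎
  where open ≤-Reasoning

neighbourDegreeSum≤deg*edges : ∀ {n} (G : Graph n) u → neighbourDegreeSum G u ≤ deg G u * edges (isolate G u)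
neighbourDegreeSum≤deg*edges {n} G u = begin
  neighbourDegreeSum G u                     ≤⟨ ∑-mono-≤ n (λ v → *-monoʳ-≤ (ind (adj G u v)) (deg≤edges H v)) ⟩
  ∑[ v < n ] (ind (adj G u v) * edges H)      ≡⟨ *-distribʳ-sum (edges H) (λ v → ind (adj G u v)) ⟨
  ∑[ v < n ] ind (adj G u v) * edges H        ≡⟨ cong (_* edges H) (deg-∑ G u) ⟨
  deg G u * edges H                          ∎
  where
  open ≤-Reasoning
  H : Graph n
  H = isolate G u

-- Upper bounds

lineEdges≤edgesC2 : ∀ {n} (G : Graph n) → lineEdges G ≤ edges G C 2
lineEdges≤edgesC2 G = <-rec P step (edges G) G refl
  where
  P : ℕ → Set
  P e = ∀ {n} (G : Graph n) → edges G ≡ e → lineEdges G ≤ e C 2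
  step : ∀ e → (∀ {e′} → e′ < e → P e′) → P e
  step _ rec {n} G refl with any? (λ u → 1 ≤? deg G u)
  ... | no noEdge = ≤-trans (≤-reflexive (lineEdges≡0 G isolated)) z≤n
    where
    isolated : ∀ v → deg G v ≡ 0
    isolated v = n≤0⇒n≡0 (≮⇒≥ (λ 0<d → noEdge (v , 0<d)))
  ... | yes (u , 0<du) = begin
    lineEdges G                                       ≡⟨ lineEdges-isolate G u ⟩
    deg G u C 2 + lineEdgesOff G u                    ≤⟨ +-monoʳ-≤ (deg G u C 2) (+-mono-≤ (rec eH<e H refl)
                                                                     (neighbourDegreeSum≤deg*edges G u)) ⟩
    deg G u C 2 + (edges H C 2 + deg G u * edges H)   ≡⟨ +-assoc (deg G u C 2) _ _ ⟨
    deg G u C 2 + edges H C 2 + deg G u * edges H     ≡⟨ C2-+ (deg G u) (edges H) ⟨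
    (deg G u + edges H) C 2                           ≡⟨ cong (_C 2) (trans (+-comm (deg G u) (edges H))
                                                                            (sym (edges-isolate G u))) ⟩
    edges G C 2                                       ∎
    where
    open ≤-Reasoning
    H : Graph n
    H = isolate G u
    eH<e : edges H < edges G
    eH<e = subst (edges H <_) (sym (edges-isolate G u)) (m<m+n (edges H) 0<du)

lineEdgesOff≤ : ∀ {n} (G : Graph n) u → lineEdgesOff G u ≤ edges (isolate G u) C 2 + 2 * edges (isolate G u)
lineEdgesOff≤ G u = +-mono-≤ (lineEdges≤edgesC2 (isolate G u)) (neighbourDegreeSum≤2*edges G u)

lineEdges≤-maxDeg : ∀ {n} (G : Graph n) Δ e → 0 < Δ → edges G ≡ Δ + e → maxDeg G ≡ Δ →
                    lineEdges G ≤ Δ C 2 + e C 2 + 2 * e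
lineEdges≤-maxDeg G Δ e 0<Δ eG≡Δ+e maxDeg≡Δ with maxDeg-vertex G 0<Δ maxDeg≡Δ
... | u , du≡Δ = begin
  lineEdges G                      ≡⟨ lineEdges-isolate G u ⟩
  deg G u C 2 + lineEdgesOff G u   ≤⟨ +-mono-≤ (≤-reflexive (cong (_C 2) du≡Δ)) (lineEdgesOff≤ G u) ⟩
  Δ C 2 + (eH C 2 + 2 * eH)        ≡⟨ cong (λ x → Δ C 2 + (x C 2 + 2 * x)) (edges-isolate-≡ G u du≡Δ eG≡Δ+e) ⟩
  Δ C 2 + (e C 2 + 2 * e)          ≡⟨ +-assoc (Δ C 2) (e C 2) (2 * e) ⟨
  Δ C 2 + e C 2 + 2 * e            ∎
  where
  open ≤-Reasoning
  eH : ℕ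
  eH = edges (isolate G u)

2k+k≤[1+k]C2+3 : ∀ k → 3 ≤ k → 2 * k + k ≤ suc k C 2 + 3
2k+k≤[1+k]C2+3 (suc (suc (suc m))) (s≤s (s≤s (s≤s _))) = begin
  2 * (3 + m) + (3 + m)                     ≤⟨ m≤m+n _ (m C 2 + m) ⟩
  2 * (3 + m) + (3 + m) + (m C 2 + m)       ≡⟨ slack (m C 2) m ⟩
  6 + m C 2 + 4 * m + 3                     ≡⟨ cong (_+ 3) (C2-+ 4 m) ⟨
  (4 + m) C 2 + 3                           ∎
  where
  open ≤-Reasoning
  slack : ∀ c m → 2 * (3 + m) + (3 + m) + (c + m) ≡ 6 + c + 4 * m + 3
  slack = solve-∀

DC2+eC2+2e+2[e+D]≤[1+e+D]C2+3 : ∀ D e → 3 ≤ D → 0 < e → D C 2 + (e C 2 + 2 * e) + 2 * (e + D) ≤ suc (e + D) C 2 + 3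
DC2+eC2+2e+2[e+D]≤[1+e+D]C2+3 (suc (suc (suc a))) (suc b) (s≤s (s≤s (s≤s _))) _ = begin
  D C 2 + (e C 2 + 2 * e) + 2 * (e + D)              ≤⟨ m≤m+n _ (a * b) ⟩
  D C 2 + (e C 2 + 2 * e) + 2 * (e + D) + a * b      ≡⟨ slack (D C 2) (e C 2) a b ⟩
  e C 2 + e + D C 2 + suc e * D + 3                  ≡⟨ cong (λ c → c + D C 2 + suc e * D + 3) (C2-suc e) ⟨
  suc e C 2 + D C 2 + suc e * D + 3                  ≡⟨ cong (_+ 3) (C2-+ (suc e) D) ⟨
  suc (e + D) C 2 + 3                                ∎
  where
  open ≤-Reasoning
  D : ℕ
  D = 3 + a
  e : ℕ
  e = suc b
  slack : ∀ cD ce a b → cD + (ce + 2 * suc b) + 2 * (suc b + (3 + a)) + a * b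
                        ≡ ce + suc b + cD + suc (suc b) * (3 + a) + 3
  slack = solve-∀

lineEdgesOff≤-sparse : ∀ {n} (G : Graph n) u → (∀ v → deg (isolate G u) v ≤ 2) →
              lineEdgesOff G u ≤ 2 * edges (isolate G u) + deg G u
lineEdgesOff≤-sparse {n} G u deg≤2 = begin
  lineEdges H + neighbourDegreeSum G u
    ≡⟨ cong (_+ neighbourDegreeSum G u) (lineEdges-∑ H) ⟩
  ∑[ v < n ] (deg H v C 2) + ∑[ v < n ] (ind (adj G u v) * deg H v)
    ≡⟨ ∑-distrib-+ (λ v → deg H v C 2) (λ v → ind (adj G u v) * deg H v) ⟨
  ∑[ v < n ] (deg H v C 2 + ind (adj G u v) * deg H v)
    ≤⟨ ∑-mono-≤ n (λ v → C2-+ind-≤ (deg H v) (adj G u v) (deg≤2 v)) ⟩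
  ∑[ v < n ] (deg H v + ind (adj G u v))
    ≡⟨ ∑-distrib-+ (deg H) (λ v → ind (adj G u v)) ⟩
  ∑[ v < n ] deg H v + ∑[ v < n ] ind (adj G u v)
    ≡⟨ cong₂ _+_ (handshake H) (sym (deg-∑ G u)) ⟩
  2 * edges H + deg G u
    ∎
  where
  open ≤-Reasoning
  H : Graph n
  H = isolate G u

lineEdgesOff≤-star : ∀ {n} (G : Graph n) u w → 0 < deg (isolate G u) w → edges (isolate (isolate G u) w) ≡ 0 →
            deg G w ≤ edges (isolate G u) →
            lineEdgesOff G u ≤ suc (edges (isolate G u)) C 2
lineEdgesOff≤-star {n} G u w 0<Dw e′≡0 dGw≤k = begin
  lineEdges H + neighbourDegreeSum G u   ≤⟨ +-mono-≤ (lineEdges≤edgesC2 H) s≤k ⟩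
  k C 2 + k                              ≡⟨ C2-suc k ⟨
  suc k C 2                              ∎
  where
  open ≤-Reasoning
  H : Graph n
  H = isolate G u
  k : ℕ
  k = edges H
  Dw≡k : deg H w ≡ k
  Dw≡k = sym (trans (edges-isolate H w) (cong (_+ deg H w) e′≡0))
  w≢u : w ≢ u
  w≢u refl = <-irrefl (sym (deg-isolate-self G w)) 0<Dw
  u≁w : adj G u w ≡ false
  u≁w with adj G u w in u~w
  ... | false = refl
  ... | true  = contradiction (≤-trans (≤-reflexive dGw≡1+k) dGw≤k) 1+n≰n
    where
    dGw≡1+k : suc k ≡ deg G w
    dGw≡1+k = sym (trans (deg-isolate G u w w≢u) (trans (cong₂ (λ d b → d + ind b) Dw≡k u~w) (+-comm k 1)))
  s+k≤k+k : neighbourDegreeSum G u + k ≤ k + k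
  s+k≤k+k = begin
    neighbourDegreeSum G u + k         ≡⟨ cong (neighbourDegreeSum G u +_) Dw≡k ⟨
    neighbourDegreeSum G u + deg H w   ≤⟨ ∑-ind-*-+-≤ n (adj G u) (deg H) w u≁w ⟩
    ∑[ v < n ] deg H v                 ≡⟨ handshake H ⟩
    2 * k                              ≡⟨ cong (k +_) (+-identityʳ k) ⟩
    k + k                              ∎
  s≤k : neighbourDegreeSum G u ≤ k
  s≤k = +-cancelʳ-≤ k _ _ s+k≤k+k

lineEdgesOff≤-hub : ∀ {n} (G : Graph n) u w → 3 ≤ deg (isolate G u) w → 0 < edges (isolate (isolate G u) w) →
                    lineEdgesOff G u ≤ suc (edges (isolate G u)) C 2 + 3
lineEdgesOff≤-hub {n} G u w 3≤D 0<e′ = begin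
  lineEdges H + neighbourDegreeSum G u            ≡⟨ cong (_+ neighbourDegreeSum G u) (lineEdges-isolate H w) ⟩
  D C 2 + lineEdgesOff H w + neighbourDegreeSum G u
    ≤⟨ +-mono-≤ (+-monoʳ-≤ (D C 2) (lineEdgesOff≤ H w)) (neighbourDegreeSum≤2*edges G u) ⟩
  D C 2 + (e′ C 2 + 2 * e′) + 2 * edges H         ≡⟨ cong (λ x → D C 2 + (e′ C 2 + 2 * e′) + 2 * x) eH≡e′+D ⟩
  D C 2 + (e′ C 2 + 2 * e′) + 2 * (e′ + D)        ≤⟨ DC2+eC2+2e+2[e+D]≤[1+e+D]C2+3 D e′ 3≤D 0<e′ ⟩
  suc (e′ + D) C 2 + 3                            ≡⟨ cong (λ x → suc x C 2 + 3) eH≡e′+D ⟨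
  suc (edges H) C 2 + 3                           ∎
  where
  open ≤-Reasoning
  H : Graph n
  H = isolate G u
  D : ℕ
  D = deg H w
  e′ : ℕ
  e′ = edges (isolate H w)
  eH≡e′+D : edges H ≡ e′ + D
  eH≡e′+D = edges-isolate H w

lineEdgesOff≤-half : ∀ {n} (G : Graph n) u k → 3 ≤ k → edges (isolate G u) ≡ k → maxDeg G ≡ k →
                     lineEdgesOff G u ≤ suc k C 2 + 3
lineEdgesOff≤-half G u k 3≤k eH≡k maxDeg≡k with any? (λ w → 3 ≤? deg (isolate G u) w)
... | no noHub = begin
  lineEdgesOff G u                    ≤⟨ lineEdgesOff≤-sparse G u (λ v → ≤-pred (≰⇒> (λ 3≤d → noHub (v , 3≤d)))) ⟩
  2 * edges (isolate G u) + deg G u   ≤⟨ +-mono-≤ (≤-reflexive (cong (2 *_) eH≡k)) (deg≤Δ G maxDeg≡k u) ⟩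
  2 * k + k                           ≤⟨ 2k+k≤[1+k]C2+3 k 3≤k ⟩
  suc k C 2 + 3                       ∎
  where open ≤-Reasoning
... | yes (w , 3≤D) with edges (isolate (isolate G u) w) in e′≡
...   | zero  = subst (λ x → lineEdgesOff G u ≤ suc x C 2 + 3) eH≡k
                  (≤-trans (lineEdgesOff≤-star G u w (≤-trans (s≤s z≤n) 3≤D) e′≡ dGw≤eH) (m≤m+n _ 3))
  where
  dGw≤eH : deg G w ≤ edges (isolate G u)
  dGw≤eH = subst (deg G w ≤_) (sym eH≡k) (deg≤Δ G maxDeg≡k w)
...   | suc _ = subst (λ x → lineEdgesOff G u ≤ suc x C 2 + 3) eH≡k
                  (lineEdgesOff≤-hub G u w 3≤D (subst (0 <_) (sym e′≡) z<s))

lineEdges≤-half : ∀ {n} (G : Graph n) k → 3 ≤ k → edges G ≡ 2 * k → maxDeg G ≡ k → lineEdges G ≤ k * k + 3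
lineEdges≤-half G k 3≤k eG≡2k maxDeg≡k with maxDeg-vertex G (≤-trans (s≤s z≤n) 3≤k) maxDeg≡k
... | u , du≡k = begin
  lineEdges G                       ≡⟨ lineEdges-isolate G u ⟩
  deg G u C 2 + lineEdgesOff G u    ≤⟨ +-mono-≤ (≤-reflexive (cong (_C 2) du≡k))
                                                (lineEdgesOff≤-half G u k 3≤k eH≡k maxDeg≡k) ⟩
  k C 2 + (suc k C 2 + 3)           ≡⟨ +-assoc (k C 2) _ 3 ⟨
  k C 2 + suc k C 2 + 3             ≡⟨ cong (_+ 3) (C2-pair k) ⟩
  k * k + 3                         ∎
  where
  open ≤-Reasoning
  eH≡k : edges (isolate G u) ≡ k
  eH≡k = edges-isolate-≡ G u du≡k (trans eG≡2k (cong (k +_) (+-identityʳ k)))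

-- Extremal graphs

attained-by-degrees : ∀ {n} (G : Graph n) {N Δ L} (d : Fin n → ℕ) → (∀ v → deg G v ≡ d v) →
                      (∀ v → 1 ≤ d v × d v ≤ Δ) → (v₀ : Fin n) → d v₀ ≡ Δ →
                      ∑[ v < n ] d v ≡ 2 * N → ∑[ v < n ] (d v C 2) ≡ L → Attained N Δ L
attained-by-degrees {n} G {N} {Δ} {L} d deg≡d d-bounds v₀ dv₀≡Δ ∑d≡2N ∑C2≡L =
  n , G , edges≡N , maxDeg≡Δ , (λ v → subst (1 ≤_) (sym (deg≡d v)) (proj₁ (d-bounds v))) , lineEdges≡L
  where
  edges≡N : edges G ≡ N
  edges≡N = *-cancelˡ-≡ _ _ 2 (trans (sym (handshake G)) (trans (sum-cong-≗ deg≡d) ∑d≡2N))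
  maxDeg≡Δ : maxDeg G ≡ Δ
  maxDeg≡Δ = ≤-antisym (maxDeg≤ G (λ v → subst (_≤ Δ) (sym (deg≡d v)) (proj₂ (d-bounds v))))
                       (subst (_≤ maxDeg G) (trans (deg≡d v₀) dv₀≡Δ) (deg≤maxDeg G v₀))
  lineEdges≡L : lineEdges G ≡ L
  lineEdges≡L = trans (lineEdges-∑ G) (trans (sum-cong-≗ (λ v → cong (_C 2) (deg≡d v))) ∑C2≡L)

n<ᵇn≡false : ∀ n → (n <ᵇ n) ≡ false
n<ᵇn≡false zero    = refl
n<ᵇn≡false (suc n) = n<ᵇn≡false n

pairAdj : (ℕ → ℕ → Bool) → ℕ → ℕ → Bool
pairAdj E i j = (E i j ∧ (i <ᵇ j)) ∨ (E j i ∧ (j <ᵇ i))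

pairGraph : ∀ n → (ℕ → ℕ → Bool) → Graph n
pairGraph n E = record
  { adj    = λ i j → pairAdj E (toℕ i) (toℕ j)
  ; sym    = λ i j → ∨-comm (E (toℕ i) (toℕ j) ∧ (toℕ i <ᵇ toℕ j)) (E (toℕ j) (toℕ i) ∧ (toℕ j <ᵇ toℕ i))
  ; irrefl = λ i → let Eii = E (toℕ i) (toℕ i) in
      trans (cong (λ b → (Eii ∧ b) ∨ (Eii ∧ b)) (n<ᵇn≡false (toℕ i))) (cong (λ b → b ∨ b) (∧-zeroʳ Eii))
  }

-- Vertices 0 and 1 are joined to all others and 2 is joined to 3: for k = 3 + m this has
-- k + 1 vertices, 2k edges and degrees k, k, 3, 3, 2, …, 2.
twoHubs : ∀ m → Graph (4 + m)
twoHubs m = pairGraph (4 + m) (λ i j → (i <ᵇ 2) ∨ ((i ≡ᵇ 2) ∧ (j ≡ᵇ 3)))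

twoHubsDeg : ℕ → ℕ → ℕ
twoHubsDeg m 0 = 3 + m
twoHubsDeg m 1 = 3 + m
twoHubsDeg m 2 = 3
twoHubsDeg m 3 = 3
twoHubsDeg m (suc (suc (suc (suc _)))) = 2

deg-twoHubs : ∀ m v → deg (twoHubs m) v ≡ twoHubsDeg m (toℕ v)
deg-twoHubs m v = trans (deg-∑ (twoHubs m) v) (row v)
  where
  row : ∀ v → ∑[ w < 4 + m ] ind (adj (twoHubs m) v w) ≡ twoHubsDeg m (toℕ v)
  row fzero                             = cong (3 +_) (∑-ones m)
  row (fsuc fzero)                      = cong (3 +_) (∑-ones m)
  row (fsuc (fsuc fzero))               = cong (3 +_) (∑-zero m)
  row (fsuc (fsuc (fsuc fzero)))        = cong (3 +_) (∑-zero m)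
  row (fsuc (fsuc (fsuc (fsuc _))))     = cong (2 +_) (∑-zero m)

twoHubs-attained : ∀ m → Attained (2 * (3 + m)) (3 + m) ((3 + m) * (3 + m) + 3)
twoHubs-attained m = attained-by-degrees (twoHubs m) (λ v → twoHubsDeg m (toℕ v)) (deg-twoHubs m) bounds fzero refl
                                         degree-sum C2-sum
  where
  open ≡-Reasoning
  bounds : ∀ v → 1 ≤ twoHubsDeg m (toℕ v) × twoHubsDeg m (toℕ v) ≤ 3 + m
  bounds fzero                         = s≤s z≤n , ≤-refl
  bounds (fsuc fzero)                  = s≤s z≤n , ≤-refl
  bounds (fsuc (fsuc fzero))           = s≤s z≤n , m≤m+n 3 m
  bounds (fsuc (fsuc (fsuc fzero)))    = s≤s z≤n , m≤m+n 3 m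
  bounds (fsuc (fsuc (fsuc (fsuc _)))) = s≤s z≤n , ≤-trans (n≤1+n 2) (m≤m+n 3 m)
  degree-sum : ∑[ v < 4 + m ] twoHubsDeg m (toℕ v) ≡ 2 * (2 * (3 + m))
  degree-sum = begin
    3 + m + (3 + m + (3 + (3 + ∑[ t < m ] 2)))   ≡⟨ cong (λ x → 3 + m + (3 + m + (3 + (3 + x)))) (∑-const m 2) ⟩
    3 + m + (3 + m + (3 + (3 + m * 2)))          ≡⟨ regroup m ⟩
    2 * (2 * (3 + m))                            ∎
    where
    regroup : ∀ m → 3 + m + (3 + m + (3 + (3 + m * 2))) ≡ 2 * (2 * (3 + m))
    regroup = solve-∀
  C2-sum : ∑[ v < 4 + m ] (twoHubsDeg m (toℕ v) C 2) ≡ (3 + m) * (3 + m) + 3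
  C2-sum = begin
    c + (c + (3 + (3 + ∑[ t < m ] 1)))   ≡⟨ cong (λ x → c + (c + (3 + (3 + x)))) (∑-ones m) ⟩
    c + (c + (3 + (3 + m)))              ≡⟨ regroup c m ⟩
    c + c + (3 + m) + 3                  ≡⟨ cong (_+ 3) (C2-double (3 + m)) ⟩
    (3 + m) * (3 + m) + 3                ∎
    where
    c : ℕ
    c = (3 + m) C 2
    regroup : ∀ c m → c + (c + (3 + (3 + m))) ≡ c + c + (3 + m) + 3
    regroup = solve-∀

-- Vertex 0 is joined to all others, vertex 1 also to 3, …, 2 + e, and vertex 2 is a pendant:
-- 3 + e vertices, 2 + 2e edges and degrees 2 + e, 1 + e, 1, 2, …, 2.
hubWithPendant : ∀ e → Graph (3 + e)
hubWithPendant e = pairGraph (3 + e) (λ i j → (i ≡ᵇ 0) ∨ ((i ≡ᵇ 1) ∧ (2 <ᵇ j)))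

hubWithPendantDeg : ℕ → ℕ → ℕ
hubWithPendantDeg e 0 = 2 + e
hubWithPendantDeg e 1 = 1 + e
hubWithPendantDeg e 2 = 1
hubWithPendantDeg e (suc (suc (suc _))) = 2

deg-hubWithPendant : ∀ e v → deg (hubWithPendant e) v ≡ hubWithPendantDeg e (toℕ v)
deg-hubWithPendant e v = trans (deg-∑ (hubWithPendant e) v) (row v)
  where
  row : ∀ v → ∑[ w < 3 + e ] ind (adj (hubWithPendant e) v w) ≡ hubWithPendantDeg e (toℕ v)
  row fzero                      = cong (2 +_) (∑-ones e)
  row (fsuc fzero)               = cong (1 +_) (∑-ones e)
  row (fsuc (fsuc fzero))        = cong (1 +_) (∑-zero e)
  row (fsuc (fsuc (fsuc _)))     = cong (2 +_) (∑-zero e)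

hubWithPendant-attained : ∀ e → Attained (2 * suc e) (2 + e) ((2 + e) C 2 + e C 2 + 2 * e)
hubWithPendant-attained e =
  attained-by-degrees (hubWithPendant e) (λ v → hubWithPendantDeg e (toℕ v)) (deg-hubWithPendant e) bounds fzero refl
                      degree-sum C2-sum
  where
  open ≡-Reasoning
  bounds : ∀ v → 1 ≤ hubWithPendantDeg e (toℕ v) × hubWithPendantDeg e (toℕ v) ≤ 2 + e
  bounds fzero                  = s≤s z≤n , ≤-refl
  bounds (fsuc fzero)           = s≤s z≤n , n≤1+n (1 + e)
  bounds (fsuc (fsuc fzero))    = s≤s z≤n , s≤s z≤n
  bounds (fsuc (fsuc (fsuc _))) = s≤s z≤n , m≤m+n 2 e
  degree-sum : ∑[ v < 3 + e ] hubWithPendantDeg e (toℕ v) ≡ 2 * (2 * suc e)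
  degree-sum = begin
    2 + e + (1 + e + (1 + ∑[ t < e ] 2))   ≡⟨ cong (λ x → 2 + e + (1 + e + (1 + x))) (∑-const e 2) ⟩
    2 + e + (1 + e + (1 + e * 2))          ≡⟨ regroup e ⟩
    2 * (2 * suc e)                        ∎
    where
    regroup : ∀ e → 2 + e + (1 + e + (1 + e * 2)) ≡ 2 * (2 * suc e)
    regroup = solve-∀
  C2-sum : ∑[ v < 3 + e ] (hubWithPendantDeg e (toℕ v) C 2) ≡ (2 + e) C 2 + e C 2 + 2 * e
  C2-sum = begin
    (2 + e) C 2 + ((1 + e) C 2 + ∑[ t < e ] 1)   ≡⟨ cong₂ (λ x y → (2 + e) C 2 + (x + y)) (C2-suc e) (∑-ones e) ⟩
    (2 + e) C 2 + (e C 2 + e + e)                ≡⟨ regroup ((2 + e) C 2) (e C 2) e ⟩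
    (2 + e) C 2 + e C 2 + 2 * e                  ∎
    where
    regroup : ∀ c c′ e → c + (c′ + e + e) ≡ c + c′ + 2 * e
    regroup = solve-∀

isF-half : ∀ k → 3 ≤ k → IsF (2 * k) k (k * k + 3)
isF-half (suc (suc (suc m))) 3≤k@(s≤s (s≤s (s≤s _))) = twoHubs-attained m , upper
  where
  upper : ∀ L → Attained (2 * (3 + m)) (3 + m) L → L ≤ (3 + m) * (3 + m) + 3
  upper L (_ , G , eG , maxDegG , _ , lG) = subst (_≤ _) lG (lineEdges≤-half G (3 + m) 3≤k eG maxDegG)

isF-half+1 : ∀ e → IsF (2 * suc e) (suc e + 1) ((2 + e) C 2 + e C 2 + 2 * e)
isF-half+1 e = subst (λ Δ → IsF (2 * suc e) Δ ((2 + e) C 2 + e C 2 + 2 * e)) (sym (+-comm (suc e) 1))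
                     (hubWithPendant-attained e , upper)
  where
  upper : ∀ L → Attained (2 * suc e) (2 + e) L → L ≤ (2 + e) C 2 + e C 2 + 2 * e
  upper L (_ , G , eG , maxDegG , _ , lG) =
    subst (_≤ _) lG (lineEdges≤-maxDeg G (2 + e) e (s≤s z≤n) (trans eG (regroup e)) maxDegG)
    where
    regroup : ∀ e → 2 * suc e ≡ 2 + e + e
    regroup = solve-∀

[1+e]²+3<[2+e]C2+eC2+2e : ∀ e → 4 ≤ e → suc e * suc e + 3 < (2 + e) C 2 + e C 2 + 2 * e
[1+e]²+3<[2+e]C2+eC2+2e e@(suc (suc (suc (suc m)))) (s≤s (s≤s (s≤s (s≤s _)))) = begin-strict
  suc e * suc e + 3                    <⟨ m<m+n _ (s≤s (z≤n {m})) ⟩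
  suc e * suc e + 3 + suc m            ≡⟨ slack m ⟩
  e * e + (1 + e) + 2 * e              ≡⟨ cong (λ x → x + (1 + e) + 2 * e) (C2-double e) ⟨
  c + c + e + (1 + e) + 2 * e          ≡⟨ regroup c e ⟩
  c + e + (1 + e) + c + 2 * e          ≡⟨ cong (λ x → x + c + 2 * e) C2-2+e ⟨
  (2 + e) C 2 + c + 2 * e              ∎
  where
  open ≤-Reasoning
  c : ℕ
  c = e C 2
  C2-2+e : (2 + e) C 2 ≡ c + e + (1 + e)
  C2-2+e = trans (C2-suc (1 + e)) (cong (_+ (1 + e)) (C2-suc e))
  slack : ∀ m → (5 + m) * (5 + m) + 3 + suc m ≡ (4 + m) * (4 + m) + (5 + m) + 2 * (4 + m)
  slack = solve-∀
  regroup : ∀ c e → c + c + e + (1 + e) + 2 * e ≡ c + e + (1 + e) + c + 2 * e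
  regroup = solve-∀

half+1-exceeds-half : ∀ k → 5 ≤ k → ∃[ a ] ∃[ b ] (IsF (2 * k) (k + 1) a × IsF (2 * k) k b × b < a)
half+1-exceeds-half (suc e) (s≤s 4≤e) =
  _ , _ , isF-half+1 e , isF-half (suc e) (≤-trans (s≤s (s≤s (s≤s z≤n))) (s≤s 4≤e)) ,
  [1+e]²+3<[2+e]C2+eC2+2e e 4≤e

mainTheorem14 : ∀ (k : ℕ) →
    (6 ≤ 2 * k → IsF (2 * k) k (k * k + 3))
    × (10 ≤ 2 * k → ∃[ a ] ∃[ b ] (IsF (2 * k) (k + 1) a × IsF (2 * k) k b × b < a))
mainTheorem14 k =
  (λ 6≤2k → isF-half k (*-cancelˡ-≤ 2 6≤2k)) ,
  (λ 10≤2k → half+1-exceeds-half k (*-cancelˡ-≤ 2 10≤2k))
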